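{- Let $n\ge2$, $S\subseteq[n]$ and $i\in[n]\setminus S$. View $\mathcal L(\mathcal D_{n,S})$ as a subset of $\mathcal L(\mathcal D_{n,S\cup\{i\}})$ (both being sets of subspaces of $\mathbb R^n$). Then a subspace $X\in\mathcal L(\mathcal D_{n,S\cup\{i\}})$ does not belong to $\mathcal L(\mathcal D_{n,S})$ if and only if $X\subseteq H_i$ and $X\not\subseteq H_k$ for every $k\ne i$.
   Context: For $S\subseteq[n]$, $\mathcal D_{n,S}$ is the arrangement in $\mathbb R^n$ consisting of the hyperplanes $\{x_k\pm x_l=0\}$ ($1\le k<l\le n$) and the coordinate hyperplanes $H_k=\{x_k=0\}$ for $k\in S$. The intersection lattice $\mathcal L(\mathcal A)$ is the set of all intersections of subsets of $\mathcal A$. Here $H_k=\{x_k=0\}$ for every $k\in[n]$, whether or not it belongs to the arrangement.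
   Formalization: The ambient space is ℚ^n instead of ℝ^n, so the hyperplanes and the subspaces X consist of points with rational coordinates. -}

module Defs where

open import Data.Nat using (ℕ)
open import Data.Fin using (Fin; _<_)
open import Data.Fin.Subset using (Subset; _∈_)
open import Data.Rational using (ℚ; 0ℚ; _+_; _-_)
open import Data.List using (List)
open import Data.List.Relation.Unary.All using (All)
open import Data.Product using (Σ; _×_)
open import Relation.Binary.PropositionalEquality using (_≡_)

Point : ℕ → Set
Point n = Fin n → ℚ

Subsp : ℕ → Set₁
Subsp n = Point n → Set

data Hyp (n : ℕ) : Set where
  coordH : Fin n → Hyp n
  plusH  : Fin n → Fin n → Hyp n
  minusH : Fin n → Fin n → Hyp n

OnHyp : {n : ℕ} → Hyp n → Point n → Set
OnHyp (coordH k) x = x k ≡ 0ℚ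
OnHyp (plusH k l) x = x k + x l ≡ 0ℚ
OnHyp (minusH k l) x = x k - x l ≡ 0ℚ

InD : {n : ℕ} → Subset n → Hyp n → Set
InD S (coordH k) = k ∈ S
InD S (plusH k l) = k < l
InD S (minusH k l) = k < l

H : {n : ℕ} → Fin n → Subsp n
H k = OnHyp (coordH k)

_⊆ˢ_ : {n : ℕ} → Subsp n → Subsp n → Set
X ⊆ˢ Y = ∀ x → X x → Y x

_≐_ : {n : ℕ} → Subsp n → Subsp n → Set
X ≐ Y = (X ⊆ˢ Y) × (Y ⊆ˢ X)

⋂ : {n : ℕ} → List (Hyp n) → Subsp n
⋂ hs x = All (λ h → OnHyp h x) hs

InL : {n : ℕ} → Subset n → Subsp n → Set
InL {n} S X = Σ (List (Hyp n)) λ hs → All (InD S) hs × (X ≐ ⋂ hs)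

{-# OPTIONS --safe #-}
-- If X ∉ L(D_{n,S}), then every presentation of X by hyperplanes of
-- D_{n,S∪{i}} must use H_i, because a presentation avoiding H_i is one in
-- D_{n,S}; hence X ⊆ H_i. If also X ⊆ H_k for some k ≠ i, the pair
-- x_i ± x_k = 0 of D_{n,S} cuts out H_i ∩ H_k ⊇ X and can replace H_i, so
-- X ∈ L(D_{n,S}) after all. Conversely, if H_i is the only coordinate
-- hyperplane containing X, then every hyperplane of D_{n,S} containing X also
-- contains the unit vector e_i (were x_i ± x_l = 0 one of them, X would lie in
-- H_l), so any intersection of such hyperplanes contains e_i ∉ H_i ⊇ X.
module Submission where

open import Defs
open import Data.Nat using (ℕ; _≤_)
open import Data.Fin using (Fin)
open import Data.Fin.Subset using (Subset; _∉_; _∪_; ⁅_⁆)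
open import Data.Product using (_×_)
open import Relation.Nullary using (¬_)
open import Relation.Binary.PropositionalEquality using (_≢_)
open import Function.Bundles using (_⇔_)

open import Data.Fin using (_<_)
open import Data.Fin.Properties using (_≟_; <-cmp; <⇒≢)
open import Data.Fin.Subset using (_∈_)
open import Data.Fin.Subset.Properties using (x∈p∪q⁻; x∈⁅y⁆⇒x≡y)
open import Data.List using (List; []; _∷_; _++_; filter)
open import Data.List.Relation.Unary.Any using (Any)
open import Data.List.Relation.Unary.All as All using (All; []; _∷_; all?)
open import Data.List.Relation.Unary.All.Properties
  using (++⁺; ++⁻; filter⁺; filter⁻; all-filter; ¬All⇒Any¬)
open import Data.Product using (_,_; proj₁; proj₂; swap)
open import Data.Rational using (ℚ; 0ℚ; 1ℚ; _+_; _-_; -_)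
import Data.Rational.Properties as ℚ
open import Data.Sum using (_⊎_; inj₁; inj₂; [_,_]′)
open import Data.Unit using (⊤; tt)
open import Function using (_∘_; id)
open import Function.Bundles using (mk⇔)
open import Relation.Binary using (tri<; tri≈; tri>)
open import Relation.Binary.PropositionalEquality
  using (_≡_; refl; sym; trans; cong; cong₂; subst; ≢-sym)
open import Relation.Nullary using (yes; no; ¬?; contradiction)
open import Relation.Nullary.Decidable using (decidable-stable)
open import Relation.Unary using (Decidable)

open import Algebra.Properties.Group ℚ.+-0-group
  using (inverseˡ-unique; inverseʳ-unique; ε⁻¹≈ε; x∙y⁻¹≈ε⇒x≈y)

private
  variable
    n : ℕ
    S : Subset n
    i : Fin n
    h : Hyp n
    X Y : Subsp n

ZeroIffZero : (ℚ → ℚ → ℚ) → Set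
ZeroIffZero _∙_ = ∀ p q → p ∙ q ≡ 0ℚ → (p ≡ 0ℚ → q ≡ 0ℚ) × (q ≡ 0ℚ → p ≡ 0ℚ)

sum-zeroIffZero : ZeroIffZero _+_
sum-zeroIffZero p q p+q≡0 =
  (λ p≡0 → trans (inverseʳ-unique p q p+q≡0) (trans (cong -_ p≡0) ε⁻¹≈ε)) ,
  (λ q≡0 → trans (inverseˡ-unique p q p+q≡0) (trans (cong -_ q≡0) ε⁻¹≈ε))

difference-zeroIffZero : ZeroIffZero _-_
difference-zeroIffZero p q p-q≡0 =
  (λ p≡0 → trans (sym p≡q) p≡0) , (λ q≡0 → trans p≡q q≡0)
  where p≡q = x∙y⁻¹≈ε⇒x≈y p q p-q≡0

p+p≡0⇒p≡0 : ∀ p → p + p ≡ 0ℚ → p ≡ 0ℚ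
p+p≡0⇒p≡0 p p+p≡0 with ℚ.<-cmp p 0ℚ
... | tri< p<0 _ _ = contradiction p+p≡0 (ℚ.<⇒≢ (ℚ.+-mono-< p<0 p<0))
... | tri≈ _ p≡0 _ = p≡0
... | tri> _ _ p>0 = contradiction (sym p+p≡0) (ℚ.<⇒≢ (ℚ.+-mono-< p>0 p>0))

p±q≡0⇒p≡0×q≡0 : ∀ p q → p + q ≡ 0ℚ → p - q ≡ 0ℚ → p ≡ 0ℚ × q ≡ 0ℚ
p±q≡0⇒p≡0×q≡0 p q p+q≡0 p-q≡0 = p≡0 , trans (sym p≡q) p≡0
  where
  p≡q = x∙y⁻¹≈ε⇒x≈y p q p-q≡0
  p≡0 = p+p≡0⇒p≡0 p (trans (cong (p +_) p≡q) p+q≡0)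

infixr 25 _∩ˢ_

_∩ˢ_ : Subsp n → Subsp n → Subsp n
(X ∩ˢ Y) x = X x × Y x

NotH : Fin n → Hyp n → Set
NotH i (coordH k) = k ≢ i
NotH i (plusH _ _) = ⊤
NotH i (minusH _ _) = ⊤

notH? : (i : Fin n) → Decidable (NotH i)
notH? i (coordH k) = ¬? (k ≟ i)
notH? i (plusH _ _) = yes tt
notH? i (minusH _ _) = yes tt

¬NotH⇒≡H : ¬ NotH i h → h ≡ coordH i
¬NotH⇒≡H {i = i} {h = coordH k} ¬k≢i = cong coordH (decidable-stable (k ≟ i) ¬k≢i)
¬NotH⇒≡H {h = plusH _ _} ¬⊤ = contradiction tt ¬⊤
¬NotH⇒≡H {h = minusH _ _} ¬⊤ = contradiction tt ¬⊤

InD-∪⁅⁆⇒InD : InD (S ∪ ⁅ i ⁆) h × NotH i h → InD S h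
InD-∪⁅⁆⇒InD {S = S} {i = i} {h = coordH k} (k∈S∪⁅i⁆ , k≢i) =
  [ id , (λ k∈⁅i⁆ → contradiction (x∈⁅y⁆⇒x≡y i k∈⁅i⁆) k≢i) ]′ (x∈p∪q⁻ S ⁅ i ⁆ k∈S∪⁅i⁆)
InD-∪⁅⁆⇒InD {h = plusH _ _} (k<l , _) = k<l
InD-∪⁅⁆⇒InD {h = minusH _ _} (k<l , _) = k<l

Any¬NotH⇒⋂⊆H : {hs : List (Hyp n)} → Any (¬_ ∘ NotH i) hs → ⋂ hs ⊆ˢ H i
Any¬NotH⇒⋂⊆H ¬NotH∈hs x x∈⋂ with All.lookupAny x∈⋂ ¬NotH∈hs
... | x∈h , ¬NotH = subst (λ g → OnHyp g x) (¬NotH⇒≡H ¬NotH) x∈h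

InL-∪⁅⁆⇒InL⊎⊆H : InL (S ∪ ⁅ i ⁆) X → InL S X ⊎ X ⊆ˢ H i
InL-∪⁅⁆⇒InL⊎⊆H {i = i} (hs , hs∈D , X≐⋂hs) with all? (notH? i) hs
... | yes notH = inj₁ (hs , All.zipWith InD-∪⁅⁆⇒InD (hs∈D , notH) , X≐⋂hs)
... | no ¬notH = inj₂ λ x x∈X →
  Any¬NotH⇒⋂⊆H (¬All⇒Any¬ (notH? i) hs ¬notH) x (proj₁ X≐⋂hs x x∈X)

-- X = Y ∩ ⋂ (hs without H_i), since X ⊆ Y ⊆ H_i.
InL-∪⁅⁆⇒InL : InL S Y → X ⊆ˢ Y → Y ⊆ˢ H i → InL (S ∪ ⁅ i ⁆) X → InL S X
InL-∪⁅⁆⇒InL {X = X} {i = i}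
  (gs , gs∈D , Y⊆⋂gs , ⋂gs⊆Y) X⊆Y Y⊆Hi (hs , hs∈D , X⊆⋂hs , ⋂hs⊆X) =
  gs ++ hs′ , ++⁺ gs∈D hs′∈D , X⊆⋂ , ⋂⊆X
  where
  hs′ = filter (notH? i) hs
  hs′∈D = All.zipWith InD-∪⁅⁆⇒InD (filter⁺ (notH? i) hs∈D , all-filter (notH? i) hs)

  X⊆⋂ : X ⊆ˢ ⋂ (gs ++ hs′)
  X⊆⋂ x x∈X = ++⁺ (Y⊆⋂gs x (X⊆Y x x∈X)) (filter⁺ (notH? i) (X⊆⋂hs x x∈X))

  ⋂⊆X : ⋂ (gs ++ hs′) ⊆ˢ X
  ⋂⊆X x x∈⋂ with ++⁻ gs x∈⋂
  ... | x∈⋂gs , x∈⋂hs′ =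
    ⋂hs⊆X x (filter⁻ (notH? i) x∈⋂hs′ (All.map onH (all-filter (¬? ∘ notH? i) hs)))
    where
    onH : ∀ {g} → ¬ NotH i g → OnHyp g x
    onH ¬NotH = subst (λ g → OnHyp g x) (sym (¬NotH⇒≡H ¬NotH)) (Y⊆Hi x (⋂gs⊆Y x x∈⋂gs))

InL-H∩H-< : {a b : Fin n} → a < b → InL S (H a ∩ˢ H b)
InL-H∩H-< {a = a} {b} a<b =
  plusH a b ∷ minusH a b ∷ [] , a<b ∷ a<b ∷ [] , H∩H⊆ , ⊆H∩H
  where
  H∩H⊆ : H a ∩ˢ H b ⊆ˢ ⋂ (plusH a b ∷ minusH a b ∷ [])
  H∩H⊆ x (xa≡0 , xb≡0) = cong₂ _+_ xa≡0 xb≡0 ∷ cong₂ _-_ xa≡0 xb≡0 ∷ []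

  ⊆H∩H : ⋂ (plusH a b ∷ minusH a b ∷ []) ⊆ˢ H a ∩ˢ H b
  ⊆H∩H x (xa+xb≡0 ∷ xa-xb≡0 ∷ []) = p±q≡0⇒p≡0×q≡0 (x a) (x b) xa+xb≡0 xa-xb≡0

InL-H∩H : {a b : Fin n} → a ≢ b → InL S (H a ∩ˢ H b)
InL-H∩H {a = a} {b} a≢b with <-cmp a b
... | tri< a<b _ _ = InL-H∩H-< a<b
... | tri≈ _ a≡b _ = contradiction a≡b a≢b
... | tri> _ _ b<a with InL-H∩H-< b<a
...   | hs , hs∈D , Hb∩Ha⊆ , ⊆Hb∩Ha =
  hs , hs∈D , (λ x → Hb∩Ha⊆ x ∘ swap) , (λ x → swap ∘ ⊆Hb∩Ha x)

basis : Fin n → Point n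
basis i j with j ≟ i
... | yes _ = 1ℚ
... | no _ = 0ℚ

basis-diag : (i : Fin n) → basis i i ≡ 1ℚ
basis-diag i with i ≟ i
... | yes _ = refl
... | no i≢i = contradiction refl i≢i

basis-off : {i j : Fin n} → j ≢ i → basis i j ≡ 0ℚ
basis-off {i = i} {j} j≢i with j ≟ i
... | yes j≡i = contradiction j≡i j≢i
... | no _ = refl

module _ {n} {X : Subsp n} {i : Fin n}
         (X⊆Hi : X ⊆ˢ H i) (X⊈Hk : ∀ k → k ≢ i → ¬ (X ⊆ˢ H k)) where

  basis-onPair : {_∙_ : ℚ → ℚ → ℚ} → 0ℚ ∙ 0ℚ ≡ 0ℚ → ZeroIffZero _∙_ →
                 {k l : Fin n} → k < l → X ⊆ˢ (λ x → x k ∙ x l ≡ 0ℚ) →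
                 basis i k ∙ basis i l ≡ 0ℚ
  basis-onPair {_∙_} 0∙0≡0 zeroIffZero {k} {l} k<l X⊆ with k ≟ i | l ≟ i
  ... | yes refl | _ = contradiction
          (λ x x∈X → proj₁ (zeroIffZero _ _ (X⊆ x x∈X)) (X⊆Hi x x∈X))
          (X⊈Hk l (≢-sym (<⇒≢ k<l)))
  ... | no k≢i | yes refl = contradiction
          (λ x x∈X → proj₂ (zeroIffZero _ _ (X⊆ x x∈X)) (X⊆Hi x x∈X))
          (X⊈Hk k k≢i)
  ... | no _ | no _ = 0∙0≡0

  basis-onHyp : i ∉ S → InD S h → X ⊆ˢ OnHyp h → OnHyp h (basis i)
  basis-onHyp {S = S} {h = coordH k} i∉S k∈S _ =
    basis-off (λ k≡i → i∉S (subst (_∈ S) k≡i k∈S))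
  basis-onHyp {h = plusH _ _} _ = basis-onPair refl sum-zeroIffZero
  basis-onHyp {h = minusH _ _} _ = basis-onPair refl difference-zeroIffZero

  ¬InL : i ∉ S → ¬ InL S X
  ¬InL i∉S (hs , hs∈D , X⊆⋂hs , ⋂hs⊆X) =
    ℚ.1≢0 (trans (sym (basis-diag i)) (X⊆Hi (basis i) (⋂hs⊆X (basis i) basis∈⋂hs)))
    where
    basis∈⋂hs : ⋂ hs (basis i)
    basis∈⋂hs = All.tabulate λ h∈hs →
      basis-onHyp i∉S (All.lookup hs∈D h∈hs) (λ x x∈X → All.lookup (X⊆⋂hs x x∈X) h∈hs)

lemma4p38 : (n : ℕ) → 2 ≤ n → (S : Subset n) → (i : Fin n) → i ∉ S →
    (X : Subsp n) → InL (S ∪ ⁅ i ⁆) X →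
    (¬ InL S X) ⇔ ((X ⊆ˢ H i) × (∀ (k : Fin n) → k ≢ i → ¬ (X ⊆ˢ H k)))
lemma4p38 n _ S i i∉S X X∈L = mk⇔ onlyH-i (λ (X⊆Hi , X⊈Hk) → ¬InL X⊆Hi X⊈Hk i∉S)
  where
  onlyH-i : ¬ InL S X → (X ⊆ˢ H i) × (∀ k → k ≢ i → ¬ (X ⊆ˢ H k))
  onlyH-i X∉L = X⊆Hi , X⊈Hk
    where
    X⊆Hi : X ⊆ˢ H i
    X⊆Hi = [ (λ X∈L′ → contradiction X∈L′ X∉L) , id ]′ (InL-∪⁅⁆⇒InL⊎⊆H X∈L)

    X⊈Hk : ∀ k → k ≢ i → ¬ (X ⊆ˢ H k)
    X⊈Hk k k≢i X⊆Hk = X∉L (InL-∪⁅⁆⇒InL (InL-H∩H (≢-sym k≢i))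
      (λ x x∈X → X⊆Hi x x∈X , X⊆Hk x x∈X) (λ _ → proj₁) X∈L)
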